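{- Let $f,h\ge 1$ be integers. Then the function $w:\mathbb{N}\to\mathbb{N}$ defined by $$w(k)=\frac{k\,\varphi(\mathrm{lcm}(k,f))}{(k,h)\,\varphi(f)}$$ is multiplicative. Furthermore, for primes $p$: (i) if $p\nmid h$ and $p\nmid f$ then $w(p)=p(p-1)$; (ii) if $p\nmid h$ and $p\mid f$ then $w(p)=p$; (iii) if $p\mid h$ and $p\nmid f$ then $w(p)=p-1$; (iv) if $p\mid h$ and $p\mid f$ then $w(p)=1$; (v) if $h$ is odd then $w(2)=2$.
   Context: $\varphi$ is Euler's totient function and $(k,h)$ denotes the gcd. -}

module Defs where

open import Data.Nat using (ℕ; suc; _*_; _≤_)
open import Data.Nat.GCD using (gcd)
open import Data.Nat.Coprimality using (Coprime; coprime?)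
open import Data.List using (List; length; filter; map; upTo)

-- Euler's totient: φ n = #{ k ∈ {1,…,n} : gcd(k,n) = 1 }  (so φ 0 = 0, φ 1 = 1)
φ : ℕ → ℕ
φ n = length (filter (λ k → coprime? k n) (map suc (upTo n)))

Multiplicative : (ℕ → ℕ) → Set
Multiplicative w =
  (w 1 ≡ 1) × (∀ m n → 1 ≤ m → 1 ≤ n → Coprime m n → w (m * n) ≡ w m * w n)
  where
    open import Relation.Binary.PropositionalEquality using (_≡_)
    open import Data.Product using (_×_)

-- Everything rests on one recurrence for Euler's totient: for a prime p,
--   φ(p n) = p φ(n)  if p ∣ n,        φ(p n) = (p − 1) φ(n)  if p ∤ n.
-- It is proved by counting residues: φ(n) counts the k < n coprime to n, an
-- n-periodic condition on k, so over the p n residues below p n it holds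
-- p φ(n) times; if p ∤ n, the multiples of p among these contribute φ(n).
-- Induction over prime factorisations then gives  φ(d) ∣ φ(n)  for d ∣ n and
--   φ(lcm(k,f)) · φ(gcd(k,f)) = φ(k) · φ(f),
-- which contains the multiplicativity of φ as the case gcd(k,f) = 1.
-- Consequently w(k) is an exact quotient, and  w(k) · (k,h) · φ((k,f)) = k φ(k).
-- Every factor in this relation other than w is multiplicative in k, hence so
-- is w; at a prime p it reads  w(p) · (p,h) · φ((p,f)) = p (p − 1).
module Submission where

open import Defs
open import Data.Nat using (ℕ; _*_; _∸_; _≤_)
open import Data.Nat.GCD using (gcd)
open import Data.Nat.LCM using (lcm)
open import Data.Nat.Divisibility using (_∣_)
open import Data.Nat.Primality using (Prime)
open import Data.Product using (Σ; _×_; _,_)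
open import Relation.Nullary using (¬_)
open import Relation.Binary.PropositionalEquality using (_≡_)

open import Data.Nat
  using (zero; suc; _+_; _<_; z≤n; s≤s; >-nonZero; nonTrivial⇒n>1)
open import Data.Nat.Properties
open import Data.Nat.Divisibility
  using ( divides; divides-refl; _∣?_; ∣-refl; ∣-trans; ∣-antisym; _∣0; ∣⇒≤
        ; ∣m∣n⇒∣m+n; ∣m+n∣m⇒∣n; 1∣_; n∣m*n; m∣m*n; ∣n⇒∣m*n
        ; *-pres-∣; *-monoʳ-∣; *-monoˡ-∣; *-cancelʳ-∣ )
open import Data.Nat.DivMod using (_/_; m/n*n≡m)
open import Data.Nat.GCD
  using (gcd[m,n]∣m; gcd[m,n]∣n; gcd-greatest; gcd[m,n]≢0; gcd-zeroˡ; c*gcd[m,n]≡gcd[cm,cn])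
open import Data.Nat.LCM using (m∣lcm[m,n]; n∣lcm[m,n]; lcm-least; gcd*lcm)
open import Data.Nat.Coprimality
  using (Coprime; coprime?; coprime-+; coprime-divisor; coprime⇒gcd≡1; 1-coprimeTo)
  renaming (sym to coprime-sym)
open import Data.Nat.Primality
  using (euclidsLemma; prime⇒irreducible; prime⇒nonTrivial; prime[2]; ¬prime[1])
open import Algebra.Properties.CommutativeSemigroup *-commutativeSemigroup using (x∙yz≈y∙xz; xy∙z≈xz∙y)
open import Algebra.Properties.CommutativeSemigroup +-commutativeSemigroup
  using () renaming (interchange to +-interchange)
open import Data.Nat.Primality.Factorisation using (factorise; PrimeFactorisation)
open import Data.Nat.ListAction using (product)
open import Data.Bool using (Bool; true; false; _∧_; not; if_then_else_)
open import Data.Bool.Properties using (∧-identityʳ; ∧-zeroʳ)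
open import Data.List using (length; filter; applyUpTo)
open import Data.List.Properties using (map-upTo; filter-accept)
open import Data.List.Relation.Unary.All using (All; []; _∷_)
open import Data.Sum using (_⊎_; inj₁; inj₂)
open import Function using (_∘_)
open import Function.Bundles using (_⇔_; mk⇔)
open import Relation.Nullary using (Dec; yes; no; does; ¬?; _×-dec_; contradiction)
open import Relation.Nullary.Decidable using (does-⇔; dec-true; dec-false)
open import Relation.Binary.PropositionalEquality
  using (refl; sym; trans; cong; cong₂; subst; _≗_; module ≡-Reasoning)
open ≡-Reasoning

⟦_⟧ : Bool → ℕ
⟦ true ⟧  = 1
⟦ false ⟧ = 0

count : (ℕ → Bool) → ℕ → ℕ
count P zero    = 0
count P (suc n) = ⟦ P 0 ⟧ + count (P ∘ suc) n

count-cong : ∀ {P Q} n → P ≗ Q → count P n ≡ count Q n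
count-cong zero    e = refl
count-cong (suc n) e = cong₂ _+_ (cong ⟦_⟧ (e 0)) (count-cong n (e ∘ suc))

count-+ : ∀ P m n → count P (m + n) ≡ count P m + count (λ k → P (m + k)) n
count-+ P zero    n = refl
count-+ P (suc m) n =
  trans (cong (⟦ P 0 ⟧ +_) (count-+ (P ∘ suc) m n)) (sym (+-assoc ⟦ P 0 ⟧ _ _))

Periodic : ℕ → (ℕ → Bool) → Set
Periodic n P = ∀ k → P (n + k) ≡ P k

count-periodic : ∀ {n P} → Periodic n P → ∀ a → count P (a * n) ≡ a * count P n
count-periodic         per zero    = refl
count-periodic {n} {P} per (suc a) = begin
  count P (n + a * n)                     ≡⟨ count-+ P n (a * n) ⟩
  count P n + count (λ k → P (n + k)) (a * n) ≡⟨ cong (count P n +_) (count-cong (a * n) per) ⟩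
  count P n + count P (a * n)             ≡⟨ cong (count P n +_) (count-periodic per a) ⟩
  count P n + a * count P n               ∎

count-rotate : ∀ {n P} → Periodic n P → count (P ∘ suc) n ≡ count P n
count-rotate {n} {P} per = +-cancelˡ-≡ ⟦ P 0 ⟧ _ _ (begin
  count P (suc n)                 ≡⟨ cong (count P) (+-comm 1 n) ⟩
  count P (n + 1)                 ≡⟨ count-+ P n 1 ⟩
  count P n + (⟦ P (n + 0) ⟧ + 0) ≡⟨ cong (λ b → count P n + (⟦ b ⟧ + 0)) (per 0) ⟩
  count P n + (⟦ P 0 ⟧ + 0)       ≡⟨ cong (count P n +_) (+-identityʳ ⟦ P 0 ⟧) ⟩
  count P n + ⟦ P 0 ⟧             ≡⟨ +-comm (count P n) ⟦ P 0 ⟧ ⟩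
  ⟦ P 0 ⟧ + count P n             ∎)

count-split : ∀ P D n → count P n ≡ count (λ k → P k ∧ not (D k)) n + count (λ k → P k ∧ D k) n
count-split P D zero    = refl
count-split P D (suc n) = begin
  ⟦ P 0 ⟧ + count (P ∘ suc) n
    ≡⟨ cong₂ _+_ (indicator-split (P 0) (D 0)) (count-split (P ∘ suc) (D ∘ suc) n) ⟩
  (⟦ P 0 ∧ not (D 0) ⟧ + ⟦ P 0 ∧ D 0 ⟧) + (count P¬D n + count PD n)
    ≡⟨ +-interchange ⟦ P 0 ∧ not (D 0) ⟧ ⟦ P 0 ∧ D 0 ⟧ (count P¬D n) (count PD n) ⟩
  (⟦ P 0 ∧ not (D 0) ⟧ + count P¬D n) + (⟦ P 0 ∧ D 0 ⟧ + count PD n) ∎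
  where
  P¬D PD : ℕ → Bool
  P¬D k = P (suc k) ∧ not (D (suc k))
  PD  k = P (suc k) ∧ D (suc k)
  indicator-split : ∀ a b → ⟦ a ⟧ ≡ ⟦ a ∧ not b ⟧ + ⟦ a ∧ b ⟧
  indicator-split true  true  = refl
  indicator-split true  false = refl
  indicator-split false b     = refl

count-none : ∀ P n → (∀ k → k < n → P k ≡ false) → count P n ≡ 0
count-none P zero    none = refl
count-none P (suc n) none rewrite none 0 (s≤s z≤n) =
  count-none (P ∘ suc) n (λ k k<n → none (suc k) (s≤s k<n))

count-multiples : ∀ p Q n → 1 ≤ p →
  count (λ k → Q k ∧ does (p ∣? k)) (n * p) ≡ count (λ j → Q (j * p)) n
count-multiples p Q zero    _   = refl
count-multiples p Q (suc n) p≥1 = begin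
  count R (p + n * p)
    ≡⟨ count-+ R p (n * p) ⟩
  count R p + count (λ k → R (p + k)) (n * p)
    ≡⟨ cong₂ _+_ (first-block p p≥1) (count-cong (n * p) shift) ⟩
  ⟦ Q 0 ⟧ + count (λ k → Q (p + k) ∧ does (p ∣? k)) (n * p)
    ≡⟨ cong (⟦ Q 0 ⟧ +_) (count-multiples p (λ k → Q (p + k)) n p≥1) ⟩
  ⟦ Q 0 ⟧ + count (λ j → Q (p + j * p)) n ∎
  where
  R : ℕ → Bool
  R k = Q k ∧ does (p ∣? k)
  -- divisibility by p is p-periodic
  shift : ∀ k → R (p + k) ≡ Q (p + k) ∧ does (p ∣? k)
  shift k = cong (Q (p + k) ∧_)
    (does-⇔ (mk⇔ (λ d → ∣m+n∣m⇒∣n d ∣-refl) (∣m∣n⇒∣m+n ∣-refl)) (p ∣? (p + k)) (p ∣? k))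
  -- the only multiple of p below p is 0
  first-block : ∀ p → 1 ≤ p → count (λ k → Q k ∧ does (p ∣? k)) p ≡ ⟦ Q 0 ⟧
  first-block (suc q) _ = begin
    ⟦ Q 0 ∧ does (suc q ∣? 0) ⟧ + count (λ k → Q (suc k) ∧ does (suc q ∣? suc k)) q
      ≡⟨ cong₂ _+_ (cong (λ b → ⟦ Q 0 ∧ b ⟧) (dec-true (suc q ∣? 0) (suc q ∣0))) (count-none _ q below) ⟩
    ⟦ Q 0 ∧ true ⟧ + 0 ≡⟨ +-identityʳ _ ⟩
    ⟦ Q 0 ∧ true ⟧     ≡⟨ cong ⟦_⟧ (∧-identityʳ (Q 0)) ⟩
    ⟦ Q 0 ⟧            ∎
    where
    below : ∀ k → k < q → Q (suc k) ∧ does (suc q ∣? suc k) ≡ false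
    below k k<q = trans (cong (Q (suc k) ∧_) (dec-false (suc q ∣? suc k) (λ d → <⇒≱ (s≤s k<q) (∣⇒≤ d))))
                        (∧-zeroʳ _)

length-filter-applyUpTo : ∀ {P : ℕ → Set} (P? : ∀ k → Dec (P k)) f n →
  length (filter P? (applyUpTo f n)) ≡ count (λ k → does (P? (f k))) n
length-filter-applyUpTo P? f zero = refl
length-filter-applyUpTo P? f (suc n) with does (P? (f 0))
... | true  = cong suc (length-filter-applyUpTo P? (f ∘ suc) n)
... | false = length-filter-applyUpTo P? (f ∘ suc) n

coprime-∣ˡ : ∀ {d k a} → d ∣ k → Coprime k a → Coprime d a
coprime-∣ˡ d∣k c (e∣d , e∣a) = c (∣-trans e∣d d∣k , e∣a)

coprime-∣ʳ : ∀ {d k a} → d ∣ a → Coprime k a → Coprime k d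
coprime-∣ʳ d∣a c (e∣k , e∣d) = c (e∣k , ∣-trans e∣d d∣a)

coprime-*ʳ : ∀ {k a b} → Coprime k a → Coprime k b → Coprime k (a * b)
coprime-*ʳ ca cb (d∣k , d∣ab) = cb (d∣k , coprime-divisor (coprime-∣ˡ d∣k ca) d∣ab)

coprime-*-∣ : ∀ {a b c} → Coprime a b → a ∣ c → b ∣ c → a * b ∣ c
coprime-*-∣ {a} {b} cab a∣c (divides-refl q) =
  *-monoˡ-∣ b (coprime-divisor cab (subst (a ∣_) (*-comm q b) a∣c))

coprime-prime⇒∤ : ∀ {p k} → Prime p → Coprime k p → ¬ p ∣ k
coprime-prime⇒∤ {p} pp c p∣k = ¬prime[1] (subst Prime (c (p∣k , ∣-refl)) pp)

∤-prime⇒coprime : ∀ {p k} → Prime p → ¬ p ∣ k → Coprime k p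
∤-prime⇒coprime pp p∤k {d} (d∣k , d∣p) with prime⇒irreducible pp d∣p
... | inj₁ d≡1 = d≡1
... | inj₂ refl = contradiction d∣k p∤k

prime≥2 : ∀ {p} → Prime p → 2 ≤ p
prime≥2 {p} pp = nonTrivial⇒n>1 p {{prime⇒nonTrivial pp}}

prime≥1 : ∀ {p} → Prime p → 1 ≤ p
prime≥1 pp = ≤-trans (s≤s z≤n) (prime≥2 pp)

prime∸1≥1 : ∀ {p} → Prime p → 1 ≤ p ∸ 1
prime∸1≥1 pp = ∸-monoˡ-≤ 1 (prime≥2 pp)

coprimeTo : ℕ → ℕ → Bool
coprimeTo n k = does (coprime? k n)

coprimeTo-periodic : ∀ n → Periodic n (coprimeTo n)
coprimeTo-periodic n k = does-⇔ (mk⇔ drop-n coprime-+) (coprime? (n + k) n) (coprime? k n)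
  where
  drop-n : Coprime (n + k) n → Coprime k n
  drop-n c (d∣k , d∣n) = c (∣m∣n⇒∣m+n d∣n d∣k , d∣n)

-- φ n counts the residues 0 ≤ k < n coprime to n (k = n is traded for k = 0).
φ-count : ∀ n → φ n ≡ count (coprimeTo n) n
φ-count n = begin
  φ n                                           ≡⟨ cong (length ∘ filter (λ k → coprime? k n)) (map-upTo suc n) ⟩
  length (filter (λ k → coprime? k n) (applyUpTo suc n)) ≡⟨ length-filter-applyUpTo (λ k → coprime? k n) suc n ⟩
  count (coprimeTo n ∘ suc) n                   ≡⟨ count-rotate {n} (coprimeTo-periodic n) ⟩
  count (coprimeTo n) n                         ∎

-- 1 is coprime to every n, so φ n ≥ 1 for n ≥ 1.
φ-pos : ∀ {n} → 1 ≤ n → 1 ≤ φ n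
φ-pos {suc m} _ = subst (λ xs → 1 ≤ length xs)
  (sym (filter-accept (λ k → coprime? k (suc m)) (1-coprimeTo (suc m)))) (s≤s z≤n)

-- If p ∣ n, then k is coprime to p n iff it is coprime to n, and the
-- n-periodic count over p n residues is p φ(n).
φ-mul-dvd : ∀ {p n} → p ∣ n → φ (p * n) ≡ p * φ n
φ-mul-dvd {p} {n} p∣n = begin
  φ (p * n)                          ≡⟨ φ-count (p * n) ⟩
  count (coprimeTo (p * n)) (p * n)  ≡⟨ count-cong (p * n) same-condition ⟩
  count (coprimeTo n) (p * n)        ≡⟨ count-periodic {n} (coprimeTo-periodic n) p ⟩
  p * count (coprimeTo n) n          ≡⟨ cong (p *_) (sym (φ-count n)) ⟩
  p * φ n                            ∎
  where
  same-condition : ∀ k → coprimeTo (p * n) k ≡ coprimeTo n k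
  same-condition k = does-⇔
    (mk⇔ (coprime-∣ʳ (n∣m*n p)) (λ c → coprime-*ʳ (coprime-∣ʳ p∣n c) c))
    (coprime? k (p * n)) (coprime? k n)

-- If p is a prime not dividing n, the residues below p n coprime to n split
-- into those coprime to p n and the multiples of p, of which there are φ(n).
φ-mul-coprime-split : ∀ {p n} → Prime p → ¬ p ∣ n → φ (p * n) + φ n ≡ p * φ n
φ-mul-coprime-split {p} {n} pp p∤n = begin
  φ (p * n) + φ n
    ≡⟨ cong₂ _+_ (trans (φ-count (p * n)) (count-cong (p * n) not-multiple)) (sym multiples) ⟩
  count (λ k → coprimeTo n k ∧ not (D k)) (p * n) + count (λ k → coprimeTo n k ∧ D k) (p * n)
    ≡⟨ sym (count-split (coprimeTo n) D (p * n)) ⟩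
  count (coprimeTo n) (p * n)  ≡⟨ count-periodic {n} (coprimeTo-periodic n) p ⟩
  p * count (coprimeTo n) n    ≡⟨ cong (p *_) (sym (φ-count n)) ⟩
  p * φ n                      ∎
  where
  D : ℕ → Bool
  D k = does (p ∣? k)
  coprime-to-pn : ∀ {k} → Coprime k (p * n) ⇔ (Coprime k n × ¬ p ∣ k)
  coprime-to-pn {k} = mk⇔ split join
    where
    split : Coprime k (p * n) → Coprime k n × ¬ p ∣ k
    split c = coprime-∣ʳ (n∣m*n p) c , coprime-prime⇒∤ pp (coprime-∣ʳ (m∣m*n n) c)
    join : Coprime k n × ¬ p ∣ k → Coprime k (p * n)
    join (c , p∤k) = coprime-*ʳ (∤-prime⇒coprime pp p∤k) c
  not-multiple : ∀ k → coprimeTo (p * n) k ≡ coprimeTo n k ∧ not (D k)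
  not-multiple k = does-⇔ coprime-to-pn (coprime? k (p * n)) (coprime? k n ×-dec ¬? (p ∣? k))
  -- p is invertible modulo n
  scaled-coprime : ∀ {j} → Coprime (j * p) n ⇔ Coprime j n
  scaled-coprime {j} = mk⇔ (coprime-∣ˡ (m∣m*n p))
    (λ (c : Coprime j n) → coprime-sym (coprime-*ʳ (coprime-sym c) (∤-prime⇒coprime pp p∤n)))
  scaled : ∀ j → coprimeTo n (j * p) ≡ coprimeTo n j
  scaled j = does-⇔ scaled-coprime (coprime? (j * p) n) (coprime? j n)
  multiples : count (λ k → coprimeTo n k ∧ D k) (p * n) ≡ φ n
  multiples = begin
    count (λ k → coprimeTo n k ∧ D k) (p * n) ≡⟨ cong (count _) (*-comm p n) ⟩
    count (λ k → coprimeTo n k ∧ D k) (n * p) ≡⟨ count-multiples p (coprimeTo n) n (prime≥1 pp) ⟩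
    count (λ j → coprimeTo n (j * p)) n       ≡⟨ count-cong n scaled ⟩
    count (coprimeTo n) n                     ≡⟨ sym (φ-count n) ⟩
    φ n                                       ∎

φ-mul-coprime : ∀ {p n} → Prime p → ¬ p ∣ n → φ (p * n) ≡ (p ∸ 1) * φ n
φ-mul-coprime {p} {n} pp p∤n = begin
  φ (p * n)             ≡⟨ sym (m+n∸n≡m (φ (p * n)) (φ n)) ⟩
  φ (p * n) + φ n ∸ φ n ≡⟨ cong (_∸ φ n) (φ-mul-coprime-split pp p∤n) ⟩
  p * φ n ∸ φ n         ≡⟨ cong (p * φ n ∸_) (sym (*-identityˡ (φ n))) ⟩
  p * φ n ∸ 1 * φ n     ≡⟨ sym (*-distribʳ-∸ (φ n) p 1) ⟩
  (p ∸ 1) * φ n         ∎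

φ-prime : ∀ {p} → Prime p → φ p ≡ p ∸ 1
φ-prime {p} pp = begin
  φ p           ≡⟨ cong φ (sym (*-identityʳ p)) ⟩
  φ (p * 1)     ≡⟨ φ-mul-coprime pp (λ p∣1 → <⇒≱ (prime≥2 pp) (∣⇒≤ p∣1)) ⟩
  (p ∸ 1) * 1   ≡⟨ *-identityʳ (p ∸ 1) ⟩
  p ∸ 1         ∎

eulerFactor : ℕ → ℕ → ℕ
eulerFactor p n = if does (p ∣? n) then p else p ∸ 1

φ-prime-mul : ∀ {p n} → Prime p → φ (p * n) ≡ eulerFactor p n * φ n
φ-prime-mul {p} {n} pp = by-cases (p ∣? n)
  where
  by-cases : (p∣?n : Dec (p ∣ n)) → φ (p * n) ≡ (if does p∣?n then p else p ∸ 1) * φ n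
  by-cases (yes p∣n) = φ-mul-dvd p∣n
  by-cases (no  p∤n) = φ-mul-coprime pp p∤n

eulerFactor-cong : ∀ {p m n} → (p ∣ m ⇔ p ∣ n) → eulerFactor p m ≡ eulerFactor p n
eulerFactor-cong {p} {m} {n} same = cong (λ b → if b then p else p ∸ 1) (does-⇔ same (p ∣? m) (p ∣? n))

prime-induction : (P : ℕ → Set) → P 1 → (∀ {p n} → Prime p → P n → P (p * n)) →
                  ∀ {n} → 1 ≤ n → P n
prime-induction P base step {n} n≥1 =
  subst P (sym (PrimeFactorisation.isFactorisation fac)) (build (PrimeFactorisation.factorsPrime fac))
  where
  fac : PrimeFactorisation n
  fac = factorise n {{>-nonZero n≥1}}
  build : ∀ {ps} → All Prime ps → P (product ps)
  build []          = base
  build (pp ∷ pps) = step pp (build pps)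

-- φ preserves divisibility: every prime step multiplies φ by a natural number.
φ-∣ : ∀ {d n} → d ∣ n → φ d ∣ φ n
φ-∣ {d} (divides-refl zero)    = φ d ∣0
φ-∣ {d} (divides-refl (suc q)) = prime-induction (λ e → φ d ∣ φ (e * d)) base step {suc q} (s≤s z≤n)
  where
  base : φ d ∣ φ (1 * d)
  base = subst (λ x → φ d ∣ φ x) (sym (*-identityˡ d)) ∣-refl
  step : ∀ {p e} → Prime p → φ d ∣ φ (e * d) → φ d ∣ φ (p * e * d)
  step {p} {e} pp ih = subst (λ x → φ d ∣ φ x) (sym (*-assoc p e d))
    (subst (φ d ∣_) (sym (φ-prime-mul pp)) (∣n⇒∣m*n (eulerFactor p (e * d)) ih))

gcd-pos : ∀ k {f} → 1 ≤ f → 1 ≤ gcd k f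
gcd-pos k {f} f≥1 = n≢0⇒n>0 (gcd[m,n]≢0 k f (inj₂ (m<n⇒n≢0 f≥1)))

lcm-1 : ∀ f → lcm 1 f ≡ f
lcm-1 f = ∣-antisym (lcm-least (1∣ f) ∣-refl) (n∣lcm[m,n] 1 f)

lcm-coprime : ∀ {m n} → Coprime m n → lcm m n ≡ m * n
lcm-coprime {m} {n} c = trans (sym (*-identityˡ (lcm m n)))
  (trans (cong (_* lcm m n) (sym (coprime⇒gcd≡1 c))) (gcd*lcm m n))

gcd-prime-∣ : ∀ {p n} → p ∣ n → gcd p n ≡ p
gcd-prime-∣ {p} {n} p∣n = ∣-antisym (gcd[m,n]∣m p n) (gcd-greatest ∣-refl p∣n)

gcd-prime-∤ : ∀ {p n} → Prime p → ¬ p ∣ n → gcd p n ≡ 1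
gcd-prime-∤ {p} {n} pp p∤n with prime⇒irreducible pp (gcd[m,n]∣m p n)
... | inj₁ gcd≡1 = gcd≡1
... | inj₂ gcd≡p = contradiction (subst (_∣ n) gcd≡p (gcd[m,n]∣n p n)) p∤n

gcd-mul-∣ : ∀ c k f → gcd (c * k) f ∣ c * gcd k f
gcd-mul-∣ c k f = subst (gcd (c * k) f ∣_) (sym (c*gcd[m,n]≡gcd[cm,cn] c k f))
  (gcd-greatest (gcd[m,n]∣m (c * k) f) (∣n⇒∣m*n c (gcd[m,n]∣n (c * k) f)))

gcd-mul-grows : ∀ c k f → c * gcd k f ∣ f → gcd (c * k) f ≡ c * gcd k f
gcd-mul-grows c k f cg∣f =
  ∣-antisym (gcd-mul-∣ c k f) (gcd-greatest (*-monoʳ-∣ c (gcd[m,n]∣m k f)) cg∣f)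

-- … and for a prime p otherwise it is unchanged, since gcd k f ∣ gcd (p k) f ∣ p gcd k f.
gcd-mul-fixed : ∀ p k f → Prime p → 1 ≤ f → ¬ (p * gcd k f ∣ f) → gcd (p * k) f ≡ gcd k f
gcd-mul-fixed p k f pp f≥1 pG∤f with gcd-greatest (∣-trans (gcd[m,n]∣m k f) (n∣m*n p)) (gcd[m,n]∣n k f)
... | divides q eq = cofactor≡1 (prime⇒irreducible pp q∣p)
  where
  -- gcd (p k) f = q · gcd k f, and q ∣ p
  q∣p : q ∣ p
  q∣p = *-cancelʳ-∣ (gcd k f) {{>-nonZero (gcd-pos k f≥1)}} (subst (_∣ p * gcd k f) eq (gcd-mul-∣ p k f))
  cofactor≡1 : q ≡ 1 ⊎ q ≡ p → gcd (p * k) f ≡ gcd k f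
  cofactor≡1 (inj₁ refl) = trans eq (*-identityˡ (gcd k f))
  cofactor≡1 (inj₂ refl) = contradiction (subst (_∣ f) eq (gcd[m,n]∣n (p * k) f)) pG∤f

-- The lcm of c k and f is determined by their gcd, since gcd · lcm = c k f.
lcm-mul : ∀ c k f {x} → 1 ≤ f → gcd (c * k) f * x ≡ c * (gcd k f * lcm k f) → lcm (c * k) f ≡ x
lcm-mul c k f {x} f≥1 eq =
  *-cancelˡ-≡ (lcm (c * k) f) x (gcd (c * k) f) {{>-nonZero (gcd-pos (c * k) f≥1)}} (begin
    gcd (c * k) f * lcm (c * k) f ≡⟨ gcd*lcm (c * k) f ⟩
    c * k * f                     ≡⟨ *-assoc c k f ⟩
    c * (k * f)                   ≡⟨ cong (c *_) (sym (gcd*lcm k f)) ⟩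
    c * (gcd k f * lcm k f)       ≡⟨ sym eq ⟩
    gcd (c * k) f * x             ∎)

gcd-multiplicative : ∀ {m n} h → Coprime m n → gcd (m * n) h ≡ gcd m h * gcd n h
gcd-multiplicative {m} {n} h c = ∣-antisym d∣gm*gn gm*gn∣d
  where
  d gm gn : ℕ
  d  = gcd (m * n) h
  gm = gcd m h
  gn = gcd n h
  d∣n*gm : d ∣ n * gm
  d∣n*gm = subst (d ∣_) (sym (c*gcd[m,n]≡gcd[cm,cn] n m h))
    (gcd-greatest (subst (d ∣_) (*-comm m n) (gcd[m,n]∣m (m * n) h)) (∣n⇒∣m*n n (gcd[m,n]∣n (m * n) h)))
  d∣gm*gn : d ∣ gm * gn
  d∣gm*gn = subst (d ∣_) (sym (c*gcd[m,n]≡gcd[cm,cn] gm n h))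
    (gcd-greatest (subst (d ∣_) (*-comm n gm) d∣n*gm) (∣n⇒∣m*n gm (gcd[m,n]∣n (m * n) h)))
  gm*gn∣d : gm * gn ∣ d
  gm*gn∣d = gcd-greatest (*-pres-∣ (gcd[m,n]∣m m h) (gcd[m,n]∣m n h))
    (coprime-*-∣ (coprime-∣ˡ (gcd[m,n]∣m m h) (coprime-∣ʳ (gcd[m,n]∣m n h) c))
                 (gcd[m,n]∣n m h) (gcd[m,n]∣n n h))

-- Passing from k to p k multiplies exactly one of gcd(k,f), lcm(k,f) by p:
-- the gcd when p · gcd(k,f) ∣ f, the lcm otherwise.  In either case p divides
-- the enlarged one iff p divides k, so φ(lcm) φ(gcd) gains the factor of φ(k).
φ-lcm*φ-gcd-gcd-grows : ∀ {p k f} → Prime p → 1 ≤ f → p * gcd k f ∣ f →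
  φ (lcm (p * k) f) * φ (gcd (p * k) f) ≡ eulerFactor p k * (φ (lcm k f) * φ (gcd k f))
φ-lcm*φ-gcd-gcd-grows {p} {k} {f} pp f≥1 pG∣f = begin
  φ (lcm (p * k) f) * φ (gcd (p * k) f) ≡⟨ cong₂ (λ a b → φ a * φ b) lcm-fixed (gcd-mul-grows p k f pG∣f) ⟩
  φ L * φ (p * G)                       ≡⟨ cong (φ L *_) (φ-prime-mul pp) ⟩
  φ L * (eulerFactor p G * φ G)         ≡⟨ x∙yz≈y∙xz (φ L) (eulerFactor p G) (φ G) ⟩
  eulerFactor p G * (φ L * φ G)         ≡⟨ cong (_* (φ L * φ G)) (eulerFactor-cong (mk⇔ p∣G⇒p∣k p∣k⇒p∣G)) ⟩
  eulerFactor p k * (φ L * φ G)         ∎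
  where
  G L : ℕ
  G = gcd k f
  L = lcm k f
  lcm-fixed : lcm (p * k) f ≡ L
  lcm-fixed = lcm-mul p k f f≥1 (trans (cong (_* L) (gcd-mul-grows p k f pG∣f)) (*-assoc p G L))
  p∣G⇒p∣k : p ∣ G → p ∣ k
  p∣G⇒p∣k p∣G = ∣-trans p∣G (gcd[m,n]∣m k f)
  p∣k⇒p∣G : p ∣ k → p ∣ G
  p∣k⇒p∣G p∣k = gcd-greatest p∣k (∣-trans (m∣m*n G) pG∣f)

φ-lcm*φ-gcd-lcm-grows : ∀ {p k f} → Prime p → 1 ≤ f → ¬ (p * gcd k f ∣ f) →
  φ (lcm (p * k) f) * φ (gcd (p * k) f) ≡ eulerFactor p k * (φ (lcm k f) * φ (gcd k f))
φ-lcm*φ-gcd-lcm-grows {p} {k} {f} pp f≥1 pG∤f = begin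
  φ (lcm (p * k) f) * φ (gcd (p * k) f) ≡⟨ cong₂ (λ a b → φ a * φ b) lcm-grows (gcd-mul-fixed p k f pp f≥1 pG∤f) ⟩
  φ (p * L) * φ G                       ≡⟨ cong (_* φ G) (φ-prime-mul pp) ⟩
  eulerFactor p L * φ L * φ G           ≡⟨ *-assoc (eulerFactor p L) (φ L) (φ G) ⟩
  eulerFactor p L * (φ L * φ G)         ≡⟨ cong (_* (φ L * φ G)) (eulerFactor-cong (mk⇔ p∣L⇒p∣k p∣k⇒p∣L)) ⟩
  eulerFactor p k * (φ L * φ G)         ∎
  where
  G L : ℕ
  G = gcd k f
  L = lcm k f
  lcm-grows : lcm (p * k) f ≡ p * L
  lcm-grows = lcm-mul p k f f≥1
    (trans (cong (_* (p * L)) (gcd-mul-fixed p k f pp f≥1 pG∤f)) (x∙yz≈y∙xz G p L))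
  p∣k⇒p∣L : p ∣ k → p ∣ L
  p∣k⇒p∣L p∣k = ∣-trans p∣k (m∣lcm[m,n] k f)
  -- p ∣ L ∣ k f; if p ∣ f but p ∤ k, then p and G are coprime and p G ∣ f
  p∣L⇒p∣k : p ∣ L → p ∣ k
  p∣L⇒p∣k p∣L with euclidsLemma k f pp (∣-trans p∣L (lcm-least (m∣m*n {k} f) (n∣m*n k)))
  ... | inj₁ p∣k = p∣k
  ... | inj₂ p∣f with p ∣? k
  ...   | yes p∣k = p∣k
  ...   | no  p∤k = contradiction (coprime-*-∣ p-coprime-G p∣f (gcd[m,n]∣n k f)) pG∤f
    where
    p-coprime-G : Coprime p G
    p-coprime-G = coprime-sym (∤-prime⇒coprime pp (λ p∣G → p∤k (∣-trans p∣G (gcd[m,n]∣m k f))))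

φ-lcm*φ-gcd-step : ∀ {p k f} → Prime p → 1 ≤ f →
  φ (lcm k f) * φ (gcd k f) ≡ φ k * φ f →
  φ (lcm (p * k) f) * φ (gcd (p * k) f) ≡ φ (p * k) * φ f
φ-lcm*φ-gcd-step {p} {k} {f} pp f≥1 ih = begin
  φ (lcm (p * k) f) * φ (gcd (p * k) f)           ≡⟨ gains-factor (p * gcd k f ∣? f) ⟩
  eulerFactor p k * (φ (lcm k f) * φ (gcd k f))  ≡⟨ cong (eulerFactor p k *_) ih ⟩
  eulerFactor p k * (φ k * φ f)                   ≡⟨ sym (*-assoc (eulerFactor p k) (φ k) (φ f)) ⟩
  eulerFactor p k * φ k * φ f                     ≡⟨ cong (_* φ f) (sym (φ-prime-mul pp)) ⟩
  φ (p * k) * φ f                                 ∎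
  where
  gains-factor : Dec (p * gcd k f ∣ f) →
    φ (lcm (p * k) f) * φ (gcd (p * k) f) ≡ eulerFactor p k * (φ (lcm k f) * φ (gcd k f))
  gains-factor (yes pG∣f) = φ-lcm*φ-gcd-gcd-grows pp f≥1 pG∣f
  gains-factor (no  pG∤f) = φ-lcm*φ-gcd-lcm-grows pp f≥1 pG∤f

φ-lcm*φ-gcd : ∀ {f} → 1 ≤ f → ∀ {k} → 1 ≤ k → φ (lcm k f) * φ (gcd k f) ≡ φ k * φ f
φ-lcm*φ-gcd {f} f≥1 = prime-induction (λ k → φ (lcm k f) * φ (gcd k f) ≡ φ k * φ f) base
  (λ pp → φ-lcm*φ-gcd-step pp f≥1)
  where
  base : φ (lcm 1 f) * φ (gcd 1 f) ≡ φ 1 * φ f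
  base = begin
    φ (lcm 1 f) * φ (gcd 1 f) ≡⟨ cong₂ (λ a b → φ a * φ b) (lcm-1 f) (gcd-zeroˡ f) ⟩
    φ f * 1                   ≡⟨ *-comm (φ f) 1 ⟩
    φ 1 * φ f                 ∎

-- φ is multiplicative: the case gcd(m,n) = 1 of the identity above.
φ-multiplicative : ∀ {m n} → 1 ≤ m → 1 ≤ n → Coprime m n → φ (m * n) ≡ φ m * φ n
φ-multiplicative {m} {n} m≥1 n≥1 c = begin
  φ (m * n)                 ≡⟨ sym (*-identityʳ (φ (m * n))) ⟩
  φ (m * n) * φ 1           ≡⟨ cong₂ (λ a b → φ a * φ b) (sym (lcm-coprime c)) (sym (coprime⇒gcd≡1 c)) ⟩
  φ (lcm m n) * φ (gcd m n) ≡⟨ φ-lcm*φ-gcd n≥1 m≥1 ⟩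
  φ m * φ n                 ∎

module Weight {f h : ℕ} (f≥1 : 1 ≤ f) (h≥1 : 1 ≤ h) where

  denominator-pos : ∀ k → 1 ≤ gcd k h * φ f
  denominator-pos k = *-mono-≤ (gcd-pos k h≥1) (φ-pos f≥1)

  -- … and divides the numerator, as (k,h) ∣ k and φ(f) ∣ φ(lcm(k,f)).
  denominator∣numerator : ∀ k → gcd k h * φ f ∣ k * φ (lcm k f)
  denominator∣numerator k = *-pres-∣ (gcd[m,n]∣m k h) (φ-∣ (n∣lcm[m,n] k f))

  w : ℕ → ℕ
  w k = _/_ (k * φ (lcm k f)) (gcd k h * φ f) {{>-nonZero (denominator-pos k)}}

  w-exact : ∀ k → w k * (gcd k h * φ f) ≡ k * φ (lcm k f)
  w-exact k = m/n*n≡m {{>-nonZero (denominator-pos k)}} (denominator∣numerator k)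

  -- What remains of the denominator after cancelling φ(f) against φ(lcm(k,f)).
  D : ℕ → ℕ
  D k = gcd k h * φ (gcd k f)

  D-pos : ∀ k → 1 ≤ D k
  D-pos k = *-mono-≤ (gcd-pos k h≥1) (φ-pos (gcd-pos k f≥1))

  -- w(k) D(k) = k φ(k), by φ(lcm(k,f)) φ(gcd(k,f)) = φ(k) φ(f).
  w-reduced : ∀ {k} → 1 ≤ k → w k * D k ≡ k * φ k
  w-reduced {k} k≥1 = *-cancelʳ-≡ (w k * D k) (k * φ k) (φ f) {{>-nonZero (φ-pos f≥1)}} (begin
    w k * D k * φ f                          ≡⟨ *-assoc (w k) (D k) (φ f) ⟩
    w k * (D k * φ f)                        ≡⟨ cong (w k *_) (xy∙z≈xz∙y (gcd k h) (φ (gcd k f)) (φ f)) ⟩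
    w k * (gcd k h * φ f * φ (gcd k f))      ≡⟨ sym (*-assoc (w k) (gcd k h * φ f) (φ (gcd k f))) ⟩
    w k * (gcd k h * φ f) * φ (gcd k f)      ≡⟨ cong (_* φ (gcd k f)) (w-exact k) ⟩
    k * φ (lcm k f) * φ (gcd k f)            ≡⟨ *-assoc k (φ (lcm k f)) (φ (gcd k f)) ⟩
    k * (φ (lcm k f) * φ (gcd k f))          ≡⟨ cong (k *_) (φ-lcm*φ-gcd f≥1 k≥1) ⟩
    k * (φ k * φ f)                          ≡⟨ sym (*-assoc k (φ k) (φ f)) ⟩
    k * φ k * φ f                            ∎)

  -- D is multiplicative, since gcd(·,h), gcd(·,f) and φ are.
  D-multiplicative : ∀ {m n} → Coprime m n → D (m * n) ≡ D m * D n
  D-multiplicative {m} {n} c = begin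
    gcd (m * n) h * φ (gcd (m * n) f)
      ≡⟨ cong₂ _*_ (gcd-multiplicative h c) (cong φ (gcd-multiplicative f c)) ⟩
    gcd m h * gcd n h * φ (gcd m f * gcd n f)
      ≡⟨ cong (gcd m h * gcd n h *_) (φ-multiplicative (gcd-pos m f≥1) (gcd-pos n f≥1) coprime-gcds) ⟩
    gcd m h * gcd n h * (φ (gcd m f) * φ (gcd n f))
      ≡⟨ [m*n]*[o*p]≡[m*o]*[n*p] (gcd m h) (gcd n h) (φ (gcd m f)) (φ (gcd n f)) ⟩
    D m * D n ∎
    where
    coprime-gcds : Coprime (gcd m f) (gcd n f)
    coprime-gcds = coprime-∣ˡ (gcd[m,n]∣m m f) (coprime-∣ʳ (gcd[m,n]∣m n f) c)

  -- w is multiplicative because k φ(k) and D are.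
  w-multiplicative : ∀ {m n} → 1 ≤ m → 1 ≤ n → Coprime m n → w (m * n) ≡ w m * w n
  w-multiplicative {m} {n} m≥1 n≥1 c =
    *-cancelʳ-≡ (w (m * n)) (w m * w n) (D (m * n)) {{>-nonZero (D-pos (m * n))}} (begin
      w (m * n) * D (m * n)     ≡⟨ w-reduced (*-mono-≤ m≥1 n≥1) ⟩
      m * n * φ (m * n)         ≡⟨ cong (m * n *_) (φ-multiplicative m≥1 n≥1 c) ⟩
      m * n * (φ m * φ n)       ≡⟨ [m*n]*[o*p]≡[m*o]*[n*p] m n (φ m) (φ n) ⟩
      m * φ m * (n * φ n)       ≡⟨ cong₂ _*_ (sym (w-reduced m≥1)) (sym (w-reduced n≥1)) ⟩
      w m * D m * (w n * D n)   ≡⟨ [m*n]*[o*p]≡[m*o]*[n*p] (w m) (D m) (w n) (D n) ⟩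
      w m * w n * (D m * D n)   ≡⟨ cong (w m * w n *_) (sym (D-multiplicative c)) ⟩
      w m * w n * D (m * n)     ∎)

  -- D(1) = 1, so w(1) = 1 · φ(1) = 1.
  w-one : w 1 ≡ 1
  w-one = begin
    w 1       ≡⟨ sym (*-identityʳ (w 1)) ⟩
    w 1 * 1   ≡⟨ cong (w 1 *_) (sym (cong₂ (λ a b → a * φ b) (gcd-zeroˡ h) (gcd-zeroˡ f))) ⟩
    w 1 * D 1 ≡⟨ w-reduced (s≤s z≤n) ⟩
    1 * φ 1   ≡⟨⟩
    1         ∎

  -- At a prime, w(p) D(p) = p (p − 1); so w(p) is read off from the value d of D(p).
  w-at-prime : ∀ {p} → Prime p → ∀ {d v} → D p ≡ d → 1 ≤ d → v * d ≡ p * (p ∸ 1) → w p ≡ v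
  w-at-prime {p} pp {d} {v} Dp≡d d≥1 v*d≡ = *-cancelʳ-≡ (w p) v d {{>-nonZero d≥1}} (begin
    w p * d       ≡⟨ cong (w p *_) (sym Dp≡d) ⟩
    w p * D p     ≡⟨ w-reduced (prime≥1 pp) ⟩
    p * φ p       ≡⟨ cong (p *_) (φ-prime pp) ⟩
    p * (p ∸ 1)   ≡⟨ sym v*d≡ ⟩
    v * d         ∎)

  -- The four prime cases: D(p) = (p,h) φ((p,f)) equals 1, p − 1, p, p (p − 1).
  w-∤h-∤f : ∀ p → Prime p → ¬ (p ∣ h) → ¬ (p ∣ f) → w p ≡ p * (p ∸ 1)
  w-∤h-∤f p pp p∤h p∤f = w-at-prime pp
    (cong₂ (λ a b → a * φ b) (gcd-prime-∤ pp p∤h) (gcd-prime-∤ pp p∤f))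
    (s≤s z≤n) (*-identityʳ (p * (p ∸ 1)))

  w-∤h-∣f : ∀ p → Prime p → ¬ (p ∣ h) → p ∣ f → w p ≡ p
  w-∤h-∣f p pp p∤h p∣f = w-at-prime pp
    (trans (cong₂ (λ a b → a * φ b) (gcd-prime-∤ pp p∤h) (gcd-prime-∣ p∣f))
           (trans (*-identityˡ (φ p)) (φ-prime pp)))
    (prime∸1≥1 pp) refl

  w-∣h-∤f : ∀ p → Prime p → p ∣ h → ¬ (p ∣ f) → w p ≡ p ∸ 1
  w-∣h-∤f p pp p∣h p∤f = w-at-prime pp
    (trans (cong₂ (λ a b → a * φ b) (gcd-prime-∣ p∣h) (gcd-prime-∤ pp p∤f)) (*-identityʳ p))
    (prime≥1 pp) (*-comm (p ∸ 1) p)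

  w-∣h-∣f : ∀ p → Prime p → p ∣ h → p ∣ f → w p ≡ 1
  w-∣h-∣f p pp p∣h p∣f = w-at-prime pp
    (trans (cong₂ (λ a b → a * φ b) (gcd-prime-∣ p∣h) (gcd-prime-∣ p∣f)) (cong (p *_) (φ-prime pp)))
    (*-mono-≤ (prime≥1 pp) (prime∸1≥1 pp)) (*-identityˡ (p * (p ∸ 1)))

  -- For odd h, w(2) is 2 · (2 − 1) or 2 according as 2 ∤ f or 2 ∣ f: both equal 2.
  w-two : ¬ (2 ∣ h) → w 2 ≡ 2
  w-two 2∤h with 2 ∣? f
  ... | yes 2∣f = w-∤h-∣f 2 prime[2] 2∤h 2∣f
  ... | no  2∤f = w-∤h-∤f 2 prime[2] 2∤h 2∤f

proposition1 : (f h : ℕ) → 1 ≤ f → 1 ≤ h →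
    Σ (ℕ → ℕ) (λ w →
      -- w is the ℕ-valued function  w(k) = k φ(lcm(k,f)) / ((k,h) φ(f))  on k ≥ 1
      (∀ k → 1 ≤ k → w k * (gcd k h * φ f) ≡ k * φ (lcm k f))
      × Multiplicative w
      × (∀ p → Prime p → ¬ (p ∣ h) → ¬ (p ∣ f) → w p ≡ p * (p ∸ 1))
      × (∀ p → Prime p → ¬ (p ∣ h) → p ∣ f → w p ≡ p)
      × (∀ p → Prime p → p ∣ h → ¬ (p ∣ f) → w p ≡ p ∸ 1)
      × (∀ p → Prime p → p ∣ h → p ∣ f → w p ≡ 1)
      × (¬ (2 ∣ h) → w 2 ≡ 2))
proposition1 f h f≥1 h≥1 =
  w , (λ k _ → w-exact k) , (w-one , λ m n m≥1 n≥1 → w-multiplicative m≥1 n≥1) ,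
  w-∤h-∤f , w-∤h-∣f , w-∣h-∤f , w-∣h-∣f , w-two
  where open Weight f≥1 h≥1
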